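{- Let $\Gamma$ be a graph and let $k>0$ be a natural number. The following are equivalent: (1) $\Gamma$ is $k$-isoregular; (2) $\Gamma$ is $[l,l+1]$-regular for every $1\le l\le k$; (3) $\Gamma$ is $(k,k+1)$-regular.
   Context: Graphs are finite simple graphs; an embedding is an injective map preserving edges and non-edges. A graph-type is a triple $\mathbb{T}=(\Delta,\iota,\Theta)$ of graphs and an embedding $\iota:\Delta\hookrightarrow\Theta$; its order is $(|V(\Delta)|,|V(\Theta)|)$. $\Gamma$ is $\mathbb{T}$-regular if the number of embeddings $\hat\kappa:\Theta\hookrightarrow\Gamma$ with $\hat\kappa\circ\iota=\kappa$ is the same for all embeddings $\kappa:\Delta\hookrightarrow\Gamma$. $\Gamma$ is $[a,b]$-regular if it is $\mathbb{T}$-regular for all graph-types of order $(a,b)$, and $(m,n)$-regular if it is $[a,b]$-regular for all $a\le m$ and $a\le b\le n$. A graph $\Gamma=(V,E)$ is $k$-isoregular if for every $X\subseteq V$ with $|X|\le k$ the number of vertices $v\notin X$ adjacent to every element of $X$ depends only on the isomorphism type of the subgraph induced by $X$. -}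

module Defs where

open import Data.Nat using (ℕ; zero; suc; _≤_)
open import Data.Fin using (Fin)
open import Data.Fin.Properties using (all?) renaming (_≟_ to _≟ᶠ_)
open import Data.Bool using (Bool; true; false)
open import Data.Bool.Properties renaming (_≟_ to _≟ᵇ_)
open import Data.Vec using (Vec; []; _∷_; lookup)
open import Data.List using (List; [_]; map; concatMap; allFin; filter; length)
open import Data.Product using (_×_)
open import Relation.Nullary using (Dec; ¬_)
open import Relation.Nullary.Decidable using (_×-dec_; _→-dec_; ¬?)
open import Relation.Binary.PropositionalEquality using (_≡_)

record Graph (n : ℕ) : Set where
  field
    adj    : Fin n → Fin n → Bool
    sym    : ∀ i j → adj i j ≡ adj j i
    irrefl : ∀ i → adj i i ≡ false
open Graph public

-- Maps Fin a → Fin n, represented as vectors (so that they can be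
-- enumerated and compared with _≡_).

Map : ℕ → ℕ → Set
Map a n = Vec (Fin n) a

allMaps : (a n : ℕ) → List (Map a n)
allMaps zero    n = [ [] ]
allMaps (suc a) n = concatMap (λ i → map (i ∷_) (allMaps a n)) (allFin n)

IsEmbedding : ∀ {a n} → Graph a → Graph n → Map a n → Set
IsEmbedding {a} Δ Γ f =
  (∀ (i j : Fin a) → lookup f i ≡ lookup f j → i ≡ j) ×
  (∀ (i j : Fin a) → adj Δ i j ≡ adj Γ (lookup f i) (lookup f j))

isEmbedding? : ∀ {a n} (Δ : Graph a) (Γ : Graph n) (f : Map a n) → Dec (IsEmbedding Δ Γ f)
isEmbedding? Δ Γ f =
  all? (λ i → all? (λ j → (lookup f i ≟ᶠ lookup f j) →-dec (i ≟ᶠ j))) ×-dec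
  all? (λ i → all? (λ j → adj Δ i j ≟ᵇ adj Γ (lookup f i) (lookup f j)))

record GraphType (a b : ℕ) : Set where
  field
    Δ    : Graph a
    Θ    : Graph b
    ι    : Map a b
    ιemb : IsEmbedding Δ Θ ι
open GraphType public

Extends : ∀ {a b n} → Map a b → Map a n → Map b n → Set
Extends {a} ι κ κ̂ = ∀ (i : Fin a) → lookup κ̂ (lookup ι i) ≡ lookup κ i

numExtensions : ∀ {a b n} → GraphType a b → Graph n → Map a n → ℕ
numExtensions {a} {b} {n} T Γ κ =
  length (filter (λ κ̂ → isEmbedding? (Θ T) Γ κ̂ ×-dec
                        all? (λ i → lookup κ̂ (lookup (ι T) i) ≟ᶠ lookup κ i))
                 (allMaps b n))

IsTRegular : ∀ {a b n} → GraphType a b → Graph n → Set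
IsTRegular {a} {b} {n} T Γ =
  ∀ (κ₁ κ₂ : Map a n) → IsEmbedding (Δ T) Γ κ₁ → IsEmbedding (Δ T) Γ κ₂ →
  numExtensions T Γ κ₁ ≡ numExtensions T Γ κ₂

IsRegular[_,_] : ∀ {n} → ℕ → ℕ → Graph n → Set
IsRegular[ a , b ] Γ = ∀ (T : GraphType a b) → IsTRegular T Γ

IsRegular⟨_,_⟩ : ∀ {N} → ℕ → ℕ → Graph N → Set
IsRegular⟨ m , n ⟩ Γ = ∀ a b → a ≤ m → a ≤ b → b ≤ n → IsRegular[ a , b ] Γ

-- A vertex set X with |X| = j is given by an injective
-- enumeration x : Fin j → V.  The induced subgraphs on X and Y are
-- isomorphic iff Y has an enumeration y with x i ~ x i' ⇔ y i ~ y i'.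

Injective : ∀ {j n} → Map j n → Set
Injective {j} x = ∀ (i i' : Fin j) → lookup x i ≡ lookup x i' → i ≡ i'

SameInducedType : ∀ {j n} → Graph n → Map j n → Map j n → Set
SameInducedType {j} Γ x y =
  ∀ (i i' : Fin j) → adj Γ (lookup x i) (lookup x i') ≡ adj Γ (lookup y i) (lookup y i')

numCommonNeighbours : ∀ {j n} → Graph n → Map j n → ℕ
numCommonNeighbours {j} {n} Γ x =
  length (filter (λ v → all? (λ i → ¬? (lookup x i ≟ᶠ v)) ×-dec
                        all? (λ i → adj Γ (lookup x i) v ≟ᵇ true))
                 (allFin n))

IsIsoregular : ∀ {n} → ℕ → Graph n → Set
IsIsoregular {n} k Γ =
  ∀ (j : ℕ) → j ≤ k → (x y : Map j n) → Injective x → Injective y →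
  SameInducedType Γ x y → numCommonNeighbours Γ x ≡ numCommonNeighbours Γ y

-- For an embedding κ of a graph G and a pattern p over its vertices, count the vertices outside κ
-- whose adjacency to κ is p; Γ is pattern-regular at b if this count depends only on G and p.
-- The count is the number of extensions along the graph-type G ↪ G + (a vertex with neighbourhood p),
-- so [b,b+1]-regularity is pattern-regularity at b. Isoregularity is the all-true case, and
-- inclusion–exclusion over the false entries of p reduces every pattern to all-true patterns of
-- sub-families. Finally, deleting a vertex w ∉ ι(Δ) from Θ writes the number of extensions along 𝕋
-- as a sum over extensions along 𝕋 − w weighted by pattern counts; hence [a,b]-regularity and
-- pattern-regularity at b give [a,b+1]-regularity, and induction from the trivial [a,a] case
-- yields (k,k+1)-regularity.

module Submission where

open import Defs
open import Data.Nat using (ℕ; zero; suc; _+_; _*_; _≤_; _<_; _≤′_; ≤′-refl; ≤′-step; z≤n; s≤s)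
import Data.Nat.Properties as ℕ
open import Algebra.Properties.CommutativeSemigroup ℕ.+-commutativeSemigroup using (interchange)
open import Data.Bool using (Bool; true; false; T; _∧_; not; if_then_else_)
open import Data.Bool.Properties using (T-∧; ∧-assoc; ∧-comm; ∧-identityʳ) renaming (_≟_ to _≟ᵇ_)
open import Data.Fin using (Fin; punchIn; punchOut)
open import Data.Fin.Properties
  using ( any?; all?; <⇒notInjective; 0≢1+n; suc-injective
        ; punchOut-injective; punchIn-punchOut; punchIn-injective; punchInᵢ≢i )
  renaming (_≟_ to _≟ᶠ_)
open import Data.List using (List; []; _∷_; _++_; allFin; tabulate; filter; concatMap; length)
open import Data.List.Properties using (++-identityʳ)
open import Data.List.Relation.Binary.Pointwise using (Pointwise; []; _∷_; ++⁺)
import Data.List as List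
open import Data.Vec using (Vec; []; _∷_; lookup; insertAt; toList; replicate)
import Data.Vec as Vec
import Data.Vec.Properties as Vecₚ
open import Data.Vec.Relation.Binary.Pointwise.Extensional using (ext; Pointwise-≡⇒≡)
open import Data.Product using (∃; _×_; _,_; proj₁; proj₂)
open import Data.Empty using (⊥-elim)
open import Function using (_∘_)
open import Function.Bundles using (_⇔_; mk⇔; Equivalence)
import Function.Definitions as Fn
open import Relation.Nullary using (Dec; yes; no; does; ¬?)
open import Relation.Nullary.Decidable using (T?; dec-false; _×-dec_)
open import Relation.Binary.PropositionalEquality as ≡
  using (_≡_; _≢_; refl; trans; cong; cong₂; subst; subst₂; module ≡-Reasoning)

𝟙 : Bool → ℕ
𝟙 true  = 1
𝟙 false = 0

∑ : {A : Set} → List A → (A → ℕ) → ℕ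
∑ []       f = 0
∑ (x ∷ xs) f = f x + ∑ xs f

*-congˡ-nonzero : ∀ m {a b} → (m ≢ 0 → a ≡ b) → m * a ≡ m * b
*-congˡ-nonzero zero    _ = refl
*-congˡ-nonzero (suc m) h = cong (suc m *_) (h λ ())

module _ {A : Set} where

  ∑-cong : (xs : List A) {f g : A → ℕ} → (∀ x → f x ≡ g x) → ∑ xs f ≡ ∑ xs g
  ∑-cong []       f≗g = refl
  ∑-cong (x ∷ xs) f≗g = cong₂ _+_ (f≗g x) (∑-cong xs f≗g)

  ∑-zero : (xs : List A) → ∑ xs (λ _ → 0) ≡ 0
  ∑-zero []       = refl
  ∑-zero (x ∷ xs) = ∑-zero xs

  ∑-++ : (xs ys : List A) (f : A → ℕ) → ∑ (xs ++ ys) f ≡ ∑ xs f + ∑ ys f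
  ∑-++ []       ys f = refl
  ∑-++ (x ∷ xs) ys f = trans (cong (f x +_) (∑-++ xs ys f)) (≡.sym (ℕ.+-assoc (f x) _ _))

  ∑-+ : (xs : List A) (f g : A → ℕ) → ∑ xs (λ x → f x + g x) ≡ ∑ xs f + ∑ xs g
  ∑-+ []       f g = refl
  ∑-+ (x ∷ xs) f g = trans (cong (f x + g x +_) (∑-+ xs f g)) (interchange (f x) (g x) _ _)

  ∑-*ˡ : (xs : List A) (c : ℕ) (f : A → ℕ) → ∑ xs (λ x → c * f x) ≡ c * ∑ xs f
  ∑-*ˡ []       c f = ≡.sym (ℕ.*-zeroʳ c)
  ∑-*ˡ (x ∷ xs) c f = trans (cong (c * f x +_) (∑-*ˡ xs c f)) (≡.sym (ℕ.*-distribˡ-+ c (f x) _))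

  ∑-*ʳ : (xs : List A) (f : A → ℕ) (c : ℕ) → ∑ xs (λ x → f x * c) ≡ ∑ xs f * c
  ∑-*ʳ []       f c = refl
  ∑-*ʳ (x ∷ xs) f c = trans (cong (f x * c +_) (∑-*ʳ xs f c)) (≡.sym (ℕ.*-distribʳ-+ c (f x) _))

  ∑-nonzero : (xs : List A) (f : A → ℕ) → ∑ xs f ≢ 0 → ∃ λ x → f x ≢ 0
  ∑-nonzero []       f ∑≢0 = ⊥-elim (∑≢0 refl)
  ∑-nonzero (x ∷ xs) f ∑≢0 with f x ℕ.≟ 0
  ... | no  fx≢0 = x , fx≢0
  ... | yes fx≡0 = ∑-nonzero xs f (λ ∑≡0 → ∑≢0 (cong₂ _+_ fx≡0 ∑≡0))

  ∑-*-zero : (xs : List A) (g f : A → ℕ) → ∑ xs g ≡ 0 → ∑ xs (λ x → g x * f x) ≡ 0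
  ∑-*-zero []       g f _   = refl
  ∑-*-zero (x ∷ xs) g f ∑≡0 =
    cong₂ _+_ (cong (_* f x) (ℕ.m+n≡0⇒m≡0 (g x) ∑≡0)) (∑-*-zero xs g f (ℕ.m+n≡0⇒n≡0 (g x) ∑≡0))

  ∑-*-constant : (xs : List A) (g f : A → ℕ) {c : ℕ} → (∀ x → g x ≢ 0 → f x ≡ c) →
                 ∑ xs (λ x → g x * f x) ≡ ∑ xs g * c
  ∑-*-constant xs g f f≡c = trans (∑-cong xs (λ x → *-congˡ-nonzero (g x) (f≡c x))) (∑-*ʳ xs g _)

  ∑-*-cong-support : (xs : List A) (g₁ g₂ f : A → ℕ) (E : A → Set) →
                     (∀ x → g₁ x ≢ 0 → E x) → (∀ x → g₂ x ≢ 0 → E x) →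
                     (∀ x y → E x → E y → f x ≡ f y) → ∑ xs g₁ ≡ ∑ xs g₂ →
                     ∑ xs (λ x → g₁ x * f x) ≡ ∑ xs (λ x → g₂ x * f x)
  ∑-*-cong-support xs g₁ g₂ f E supp₁ supp₂ f-const ∑g₁≡∑g₂ with ∑ xs g₁ ℕ.≟ 0
  ... | yes ∑g₁≡0 =
    trans (∑-*-zero xs g₁ f ∑g₁≡0) (≡.sym (∑-*-zero xs g₂ f (trans (≡.sym ∑g₁≡∑g₂) ∑g₁≡0)))
  ... | no  ∑g₁≢0 = begin
    ∑ xs (λ x → g₁ x * f x) ≡⟨ ∑-*-constant xs g₁ f (λ x gx≢0 → f-const x x₀ (supp₁ x gx≢0) Ex₀) ⟩
    ∑ xs g₁ * f x₀          ≡⟨ cong (_* f x₀) ∑g₁≡∑g₂ ⟩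
    ∑ xs g₂ * f x₀          ≡⟨ ∑-*-constant xs g₂ f (λ x gx≢0 → f-const x x₀ (supp₂ x gx≢0) Ex₀) ⟨
    ∑ xs (λ x → g₂ x * f x) ∎
    where
    open ≡-Reasoning
    x₀ = proj₁ (∑-nonzero xs g₁ ∑g₁≢0)
    Ex₀ = supp₁ x₀ (proj₂ (∑-nonzero xs g₁ ∑g₁≢0))

  length-filter : {P : A → Set} (P? : ∀ x → Dec (P x)) (xs : List A) →
                  length (filter P? xs) ≡ ∑ xs (𝟙 ∘ does ∘ P?)
  length-filter P? []       = refl
  length-filter P? (x ∷ xs) with does (P? x)
  ... | false = length-filter P? xs
  ... | true  = cong suc (length-filter P? xs)

module _ {A B : Set} where

  ∑-map : (g : A → B) (xs : List A) (f : B → ℕ) → ∑ (List.map g xs) f ≡ ∑ xs (f ∘ g)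
  ∑-map g []       f = refl
  ∑-map g (x ∷ xs) f = cong (f (g x) +_) (∑-map g xs f)

  ∑-concatMap : (g : A → List B) (xs : List A) (f : B → ℕ) →
                ∑ (concatMap g xs) f ≡ ∑ xs (λ x → ∑ (g x) f)
  ∑-concatMap g []       f = refl
  ∑-concatMap g (x ∷ xs) f =
    trans (∑-++ (g x) (concatMap g xs) f) (cong (∑ (g x) f +_) (∑-concatMap g xs f))

  ∑-comm : (xs : List A) (ys : List B) (f : A → B → ℕ) →
           ∑ xs (λ x → ∑ ys (f x)) ≡ ∑ ys (λ y → ∑ xs (λ x → f x y))
  ∑-comm []       ys f = ≡.sym (∑-zero ys)
  ∑-comm (x ∷ xs) ys f = trans (cong (∑ ys (f x) +_) (∑-comm xs ys f)) (≡.sym (∑-+ ys (f x) _))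

∑-tabulate : {A : Set} {m : ℕ} (g : Fin m → A) (f : A → ℕ) → ∑ (tabulate g) f ≡ ∑ (allFin m) (f ∘ g)
∑-tabulate {m = zero}  g f = refl
∑-tabulate {m = suc m} g f =
  cong (f (g Fin.zero) +_) (trans (∑-tabulate (g ∘ Fin.suc) f) (≡.sym (∑-tabulate Fin.suc (f ∘ g))))

∑-allFin-suc : {m : ℕ} (f : Fin (suc m) → ℕ) → ∑ (allFin (suc m)) f ≡ f Fin.zero + ∑ (allFin m) (f ∘ Fin.suc)
∑-allFin-suc f = cong (f Fin.zero +_) (∑-tabulate Fin.suc f)

∑-allFin-δ : {m : ℕ} (u : Fin m) (g : Fin m → Bool) → ∑ (allFin m) (λ v → 𝟙 (does (v ≟ᶠ u) ∧ g v)) ≡ 𝟙 (g u)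
∑-allFin-δ {suc m} Fin.zero g =
  trans (∑-allFin-suc (λ v → 𝟙 (does (v ≟ᶠ Fin.zero) ∧ g v)))
        (trans (cong (𝟙 (g Fin.zero) +_) (∑-zero (allFin m))) (ℕ.+-identityʳ _))
∑-allFin-δ {suc m} (Fin.suc u) g =
  trans (∑-allFin-suc (λ v → 𝟙 (does (v ≟ᶠ Fin.suc u) ∧ g v))) (∑-allFin-δ u (g ∘ Fin.suc))

𝟙-∧ : ∀ a b → 𝟙 (a ∧ b) ≡ 𝟙 a * 𝟙 b
𝟙-∧ true  true  = refl
𝟙-∧ true  false = refl
𝟙-∧ false b     = refl

𝟙-cong : {P Q : Set} (P? : Dec P) (Q? : Dec Q) → P ⇔ Q → 𝟙 (does P?) ≡ 𝟙 (does Q?)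
𝟙-cong (yes p) (yes q) P⇔Q = refl
𝟙-cong (yes p) (no ¬q) P⇔Q = ⊥-elim (¬q (Equivalence.to P⇔Q p))
𝟙-cong (no ¬p) (yes q) P⇔Q = ⊥-elim (¬p (Equivalence.from P⇔Q q))
𝟙-cong (no ¬p) (no ¬q) P⇔Q = refl

𝟙-nonzero : {P : Set} (P? : Dec P) → 𝟙 (does P?) ≢ 0 → P
𝟙-nonzero (yes p) _   = p
𝟙-nonzero (no _)  𝟙≢0 = ⊥-elim (𝟙≢0 refl)

module _ {n : ℕ} where

  ∑-allMaps-suc : (b : ℕ) (F : Map (suc b) n → ℕ) →
                  ∑ (allMaps (suc b) n) F ≡ ∑ (allFin n) (λ v → ∑ (allMaps b n) (λ κ → F (v ∷ κ)))
  ∑-allMaps-suc b F = trans (∑-concatMap (λ v → List.map (v ∷_) (allMaps b n)) (allFin n) F)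
                            (∑-cong (allFin n) (λ v → ∑-map (v ∷_) (allMaps b n) F))

  ∑-allMaps-insertAt : (b : ℕ) (w : Fin (suc b)) (F : Map (suc b) n → ℕ) →
                       ∑ (allMaps (suc b) n) F ≡ ∑ (allMaps b n) (λ κ → ∑ (allFin n) (λ v → F (insertAt κ w v)))
  ∑-allMaps-insertAt b Fin.zero F =
    trans (∑-allMaps-suc b F) (∑-comm (allFin n) (allMaps b n) (λ v κ → F (v ∷ κ)))
  ∑-allMaps-insertAt (suc b) (Fin.suc w) F =
    trans (∑-allMaps-suc (suc b) F)
      (trans (∑-cong (allFin n) (λ u → ∑-allMaps-insertAt b w (λ κ → F (u ∷ κ))))
        (≡.sym (∑-allMaps-suc b (λ κ → ∑ (allFin n) (λ v → F (insertAt κ (Fin.suc w) v))))))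

  _≟ᵐ_ : {m : ℕ} (κ κ′ : Map m n) → Dec (κ ≡ κ′)
  _≟ᵐ_ = Vecₚ.≡-dec _≟ᶠ_

  ∑-allMaps-δ : (m : ℕ) (κ₀ : Map m n) → ∑ (allMaps m n) (λ κ → 𝟙 (does (κ ≟ᵐ κ₀))) ≡ 1
  ∑-allMaps-δ zero    []       = refl
  ∑-allMaps-δ (suc m) (u ∷ κ₀) = begin
    ∑ (allMaps (suc m) n) (λ κ → 𝟙 (does (κ ≟ᵐ (u ∷ κ₀))))
      ≡⟨ ∑-allMaps-suc m _ ⟩
    ∑ (allFin n) (λ v → ∑ (allMaps m n) (λ κ → 𝟙 (does (v ≟ᶠ u) ∧ does (κ ≟ᵐ κ₀))))
      ≡⟨ ∑-cong (allFin n) (λ v → trans (∑-cong (allMaps m n) (λ κ → 𝟙-∧ (does (v ≟ᶠ u)) _))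
                                        (∑-*ˡ (allMaps m n) (𝟙 (does (v ≟ᶠ u))) _)) ⟩
    ∑ (allFin n) (λ v → 𝟙 (does (v ≟ᶠ u)) * ∑ (allMaps m n) (λ κ → 𝟙 (does (κ ≟ᵐ κ₀))))
      ≡⟨ ∑-cong (allFin n) (λ v → trans (cong (𝟙 (does (v ≟ᶠ u)) *_) (∑-allMaps-δ m κ₀))
                                        (≡.sym (𝟙-∧ (does (v ≟ᶠ u)) true))) ⟩
    ∑ (allFin n) (λ v → 𝟙 (does (v ≟ᶠ u) ∧ true))
      ≡⟨ ∑-allFin-δ u (λ _ → true) ⟩
    1 ∎
    where open ≡-Reasoning

∃-outsideImage : {a m : ℕ} → a < m → (f : Map a m) → ∃ λ w → ∀ i → lookup f i ≢ w
∃-outsideImage a<m f with any? (λ w → all? (λ i → ¬? (lookup f i ≟ᶠ w)))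
... | yes found = found
... | no ¬found = ⊥-elim (<⇒notInjective a<m preimage-injective)
  where
  preimage : ∀ w → ∃ λ i → lookup f i ≡ w
  preimage w with any? (λ i → lookup f i ≟ᶠ w)
  ... | yes hit = hit
  ... | no ¬hit = ⊥-elim (¬found (w , λ i fi≡w → ¬hit (i , fi≡w)))
  preimage-injective : Fn.Injective _≡_ _≡_ (proj₁ ∘ preimage)
  preimage-injective {w₁} {w₂} eq =
    trans (≡.sym (proj₂ (preimage w₁))) (trans (cong (lookup f) eq) (proj₂ (preimage w₂)))

injective⇒surjective : {a : ℕ} (f : Map a a) → Injective f → ∀ j → ∃ λ i → lookup f i ≡ j
injective⇒surjective {suc a} f f-inj j with any? (λ i → lookup f i ≟ᶠ j)
... | yes hit = hit
... | no ¬hit = ⊥-elim (<⇒notInjective (ℕ.n<1+n a) squeeze-injective)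
  where
  j≢f : ∀ i → j ≢ lookup f i
  j≢f i j≡fi = ¬hit (i , ≡.sym j≡fi)
  squeeze-injective : Fn.Injective _≡_ _≡_ (λ i → punchOut (j≢f i))
  squeeze-injective {i₁} {i₂} eq = f-inj i₁ i₂ (punchOut-injective (j≢f i₁) (j≢f i₂) eq)

module _ {A : Set} {R : A → A → Set} where

  Pointwise-toList-++⁻ : {t : ℕ} (xs₁ xs₂ : Vec A t) {ys₁ ys₂ : List A} →
                         Pointwise R (toList xs₁ ++ ys₁) (toList xs₂ ++ ys₂) →
                         Pointwise R (toList xs₁) (toList xs₂) × Pointwise R ys₁ ys₂
  Pointwise-toList-++⁻ []         []         rs       = [] , rs
  Pointwise-toList-++⁻ (x₁ ∷ xs₁) (x₂ ∷ xs₂) (r ∷ rs) =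
    Data.Product.map₁ (r ∷_) (Pointwise-toList-++⁻ xs₁ xs₂ rs)

  Pointwise-toList⁻ : {t : ℕ} (xs₁ xs₂ : Vec A t) → Pointwise R (toList xs₁) (toList xs₂) →
                      ∀ i → R (lookup xs₁ i) (lookup xs₂ i)
  Pointwise-toList⁻ (x₁ ∷ xs₁) (x₂ ∷ xs₂) (r ∷ rs) Fin.zero    = r
  Pointwise-toList⁻ (x₁ ∷ xs₁) (x₂ ∷ xs₂) (r ∷ rs) (Fin.suc i) = Pointwise-toList⁻ xs₁ xs₂ rs i

  Pointwise-toList⁺ : {t : ℕ} (xs₁ xs₂ : Vec A t) → (∀ i → R (lookup xs₁ i) (lookup xs₂ i)) →
                      Pointwise R (toList xs₁) (toList xs₂)
  Pointwise-toList⁺ []         []         rs = []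
  Pointwise-toList⁺ (x₁ ∷ xs₁) (x₂ ∷ xs₂) rs = rs Fin.zero ∷ Pointwise-toList⁺ xs₁ xs₂ (rs ∘ Fin.suc)

agree : Bool → Bool → Bool
agree x b = if b then x else not x

agree⇔≡ : ∀ x b → T (agree x b) ⇔ x ≡ b
agree⇔≡ true  true  = mk⇔ (λ _ → refl) _
agree⇔≡ true  false = mk⇔ (λ ()) (λ ())
agree⇔≡ false true  = mk⇔ (λ ()) (λ ())
agree⇔≡ false false = mk⇔ (λ _ → refl) _

-- With e standing for v ≡ u and a for adjacency of u and v, the three terms count the vertices
-- that are non-adjacent to u, adjacent to u, and equal to u.
𝟙-split : ∀ A B e a → 𝟙 (A ∧ B) ≡ 𝟙 (A ∧ ((not e ∧ not a) ∧ B)) + 𝟙 (((not e ∧ a) ∧ A) ∧ B) + 𝟙 (e ∧ (A ∧ B))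
𝟙-split true  true  true  a     = refl
𝟙-split true  false true  a     = refl
𝟙-split false B     true  a     = refl
𝟙-split true  true  false true  = refl
𝟙-split true  true  false false = refl
𝟙-split true  false false true  = refl
𝟙-split true  false false false = refl
𝟙-split false B     false true  = refl
𝟙-split false B     false false = refl

+-cancelʳ₂-≡ : ∀ b c {a₁ a₂} → a₁ + b + c ≡ a₂ + b + c → a₁ ≡ a₂
+-cancelʳ₂-≡ b c {a₁} {a₂} eq = ℕ.+-cancelʳ-≡ b a₁ a₂ (ℕ.+-cancelʳ-≡ c (a₁ + b) (a₂ + b) eq)

deleteVertex : {b : ℕ} → Graph (suc b) → Fin (suc b) → Graph b
deleteVertex H w = record
  { adj    = λ i j → adj H (punchIn w i) (punchIn w j)
  ; sym    = λ i j → sym H (punchIn w i) (punchIn w j)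
  ; irrefl = λ i → irrefl H (punchIn w i)
  }

neighbourhoodPattern : {b : ℕ} → Graph (suc b) → Fin (suc b) → Vec Bool b
neighbourhoodPattern H w = Vec.tabulate (λ j → adj H (punchIn w j) w)

addVertex : {b : ℕ} → Graph b → Vec Bool b → Graph (suc b)
addVertex G p = record { adj = adj′ ; sym = sym′ ; irrefl = irrefl′ }
  where
  adj′ : Fin _ → Fin _ → Bool
  adj′ Fin.zero    Fin.zero    = false
  adj′ Fin.zero    (Fin.suc j) = lookup p j
  adj′ (Fin.suc i) Fin.zero    = lookup p i
  adj′ (Fin.suc i) (Fin.suc j) = adj G i j
  sym′ : ∀ i j → adj′ i j ≡ adj′ j i
  sym′ Fin.zero    Fin.zero    = refl
  sym′ Fin.zero    (Fin.suc j) = refl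
  sym′ (Fin.suc i) Fin.zero    = refl
  sym′ (Fin.suc i) (Fin.suc j) = sym G i j
  irrefl′ : ∀ i → adj′ i i ≡ false
  irrefl′ Fin.zero    = refl
  irrefl′ (Fin.suc i) = irrefl G i

data PunchInView {b : ℕ} (w : Fin (suc b)) : Fin (suc b) → Set where
  at-w    : PunchInView w w
  punched : ∀ j → PunchInView w (punchIn w j)

punchInView : {b : ℕ} (w j : Fin (suc b)) → PunchInView w j
punchInView w j with w ≟ᶠ j
... | yes refl = at-w
... | no  w≢j  = subst (PunchInView w) (punchIn-punchOut w≢j) (punched (punchOut w≢j))

-- Vertices realising an adjacency pattern

module _ {n : ℕ} (Γ : Graph n) where

  fits : Fin n → Bool → Fin n → Bool
  fits u b v = not (does (v ≟ᶠ u)) ∧ agree (adj Γ u v) b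

  matches : {m : ℕ} → Map m n → Vec Bool m → Fin n → Bool
  matches []       []       v = true
  matches (u ∷ us) (b ∷ bs) v = fits u b v ∧ matches us bs v

  count : (Fin n → Bool) → ℕ
  count P = ∑ (allFin n) (𝟙 ∘ P)

  numRealisations : {m : ℕ} → Map m n → Vec Bool m → ℕ
  numRealisations κ p = count (matches κ p)

  Realises : {m : ℕ} → Map m n → Vec Bool m → Fin n → Set
  Realises κ p v = ∀ j → lookup κ j ≢ v × adj Γ (lookup κ j) v ≡ lookup p j

  fits⇔ : ∀ u b v → T (fits u b v) ⇔ (u ≢ v × adj Γ u v ≡ b)
  fits⇔ u b v with v ≟ᶠ u
  ... | yes v≡u = mk⇔ (λ ()) (λ (u≢v , _) → ⊥-elim (u≢v (≡.sym v≡u)))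
  ... | no  v≢u = mk⇔ (λ t → (v≢u ∘ ≡.sym) , Equivalence.to (agree⇔≡ (adj Γ u v) b) t)
                      (λ (_ , a≡b) → Equivalence.from (agree⇔≡ (adj Γ u v) b) a≡b)

  matches⇔ : {m : ℕ} (κ : Map m n) (p : Vec Bool m) (v : Fin n) → T (matches κ p v) ⇔ Realises κ p v
  matches⇔ []       []       v = mk⇔ (λ _ ()) _
  matches⇔ (u ∷ us) (b ∷ bs) v = mk⇔ to from
    where
    to : T (matches (u ∷ us) (b ∷ bs) v) → Realises (u ∷ us) (b ∷ bs) v
    to t with Equivalence.to T-∧ t
    ... | t₁ , t₂ = λ { Fin.zero → Equivalence.to (fits⇔ u b v) t₁
                      ; (Fin.suc j) → Equivalence.to (matches⇔ us bs v) t₂ j }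
    from : Realises (u ∷ us) (b ∷ bs) v → T (matches (u ∷ us) (b ∷ bs) v)
    from r = Equivalence.from T-∧ ( Equivalence.from (fits⇔ u b v) (r Fin.zero)
                                  , Equivalence.from (matches⇔ us bs v) (r ∘ Fin.suc))

  numCommonNeighbours≡numRealisations : {m : ℕ} (x : Map m n) →
                                        numCommonNeighbours Γ x ≡ numRealisations x (replicate m true)
  numCommonNeighbours≡numRealisations {m} x = trans (length-filter _ (allFin n)) (∑-cong (allFin n) λ v →
    𝟙-cong (all? (λ i → ¬? (lookup x i ≟ᶠ v)) ×-dec all? (λ i → adj Γ (lookup x i) v ≟ᵇ true))
           (T? (matches x (replicate m true) v)) (mk⇔
      (λ (x≢v , adj≡true) → Equivalence.from (matches⇔ x _ v)
                              (λ j → x≢v j , trans (adj≡true j) (≡.sym (Vecₚ.lookup-replicate j true))))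
      (λ t → let r = Equivalence.to (matches⇔ x _ v) t
             in (λ j → proj₁ (r j)) , (λ j → trans (proj₂ (r j)) (Vecₚ.lookup-replicate j true)))))

  PatternRegular : ℕ → Set
  PatternRegular b = ∀ (G : Graph b) (κ₁ κ₂ : Map b n) → IsEmbedding G Γ κ₁ → IsEmbedding G Γ κ₂ →
                     ∀ p → numRealisations κ₁ p ≡ numRealisations κ₂ p

  Compatible : Fin n → Fin n → Fin n → Fin n → Set
  Compatible x y x′ y′ = x ≢ x′ × y ≢ y′ × adj Γ x x′ ≡ adj Γ y y′

  Compatible-sym : ∀ {x y x′ y′} → Compatible x y x′ y′ → Compatible x′ y′ x y
  Compatible-sym {x} {y} {x′} {y′} (x≢x′ , y≢y′ , adj≡) =
    (x≢x′ ∘ ≡.sym) , (y≢y′ ∘ ≡.sym) , trans (sym Γ x′ x) (trans adj≡ (sym Γ y y′))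

  -- The two sequences consist of distinct vertices and i ↦ i is an isomorphism of the induced graphs.
  data Similar : List (Fin n) → List (Fin n) → Set where
    nil  : Similar [] []
    cons : ∀ {x y xs ys} → Pointwise (Compatible x y) xs ys → Similar xs ys → Similar (x ∷ xs) (y ∷ ys)

  Similar-toFront : {t : ℕ} (xs₁ xs₂ : Map t n) {u₁ u₂ : Fin n} {ys₁ ys₂ : List (Fin n)} →
                    Similar (toList xs₁ ++ u₁ ∷ ys₁) (toList xs₂ ++ u₂ ∷ ys₂) →
                    Similar (u₁ ∷ toList xs₁ ++ ys₁) (u₂ ∷ toList xs₂ ++ ys₂)
  Similar-toFront []         []         s          = s
  Similar-toFront (x₁ ∷ xs₁) (x₂ ∷ xs₂) (cons c s) with Pointwise-toList-++⁻ xs₁ xs₂ c | Similar-toFront xs₁ xs₂ s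
  ... | c-xs , c-u ∷ c-ys | cons c′ s′ = cons (Compatible-sym c-u ∷ c′) (cons (++⁺ c-xs c-ys) s′)

  Similar⁺ : {m : ℕ} (x y : Map m n) → Injective x → Injective y → SameInducedType Γ x y →
             Similar (toList x) (toList y)
  Similar⁺ []      []      _      _      _    = nil
  Similar⁺ (u ∷ x) (v ∷ y) inj-ux inj-vy same =
    cons (Pointwise-toList⁺ x y λ i → head-fresh inj-ux i , head-fresh inj-vy i , same Fin.zero (Fin.suc i))
         (Similar⁺ x y (tail-injective inj-ux) (tail-injective inj-vy) (λ i i′ → same (Fin.suc i) (Fin.suc i′)))
    where
    head-fresh : ∀ {w} {z : Map _ n} → Injective (w ∷ z) → ∀ i → w ≢ lookup z i
    head-fresh inj i eq = 0≢1+n (inj Fin.zero (Fin.suc i) eq)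
    tail-injective : ∀ {w} {z : Map _ n} → Injective (w ∷ z) → Injective z
    tail-injective inj i i′ eq = suc-injective (inj (Fin.suc i) (Fin.suc i′) eq)

  Similar⁻ : {m : ℕ} (x y : Map m n) → Similar (toList x) (toList y) →
             Injective x × Injective y × SameInducedType Γ x y
  Similar⁻ []      []      nil        = (λ ()) , (λ ()) , (λ ())
  Similar⁻ (u ∷ x) (v ∷ y) (cons c s) with Similar⁻ x y s
  ... | inj-x , inj-y , same-xy =
    cons-injective (proj₁ ∘ compat) inj-x , cons-injective (proj₁ ∘ proj₂ ∘ compat) inj-y , same
    where
    compat : ∀ i → Compatible u v (lookup x i) (lookup y i)
    compat = Pointwise-toList⁻ x y c
    cons-injective : ∀ {w} {z : Map _ n} → (∀ i → w ≢ lookup z i) → Injective z → Injective (w ∷ z)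
    cons-injective fresh inj Fin.zero    Fin.zero     eq = refl
    cons-injective fresh inj Fin.zero    (Fin.suc i′) eq = ⊥-elim (fresh i′ eq)
    cons-injective fresh inj (Fin.suc i) Fin.zero     eq = ⊥-elim (fresh i (≡.sym eq))
    cons-injective fresh inj (Fin.suc i) (Fin.suc i′) eq = cong Fin.suc (inj i i′ eq)
    same : SameInducedType Γ (u ∷ x) (v ∷ y)
    same Fin.zero    Fin.zero     = trans (irrefl Γ u) (≡.sym (irrefl Γ v))
    same Fin.zero    (Fin.suc i′) = proj₂ (proj₂ (compat i′))
    same (Fin.suc i) Fin.zero     = proj₂ (proj₂ (Compatible-sym (compat i)))
    same (Fin.suc i) (Fin.suc i′) = same-xy i i′

  fits-cong : ∀ {v₁ v₂ x₁ x₂} b → Compatible v₁ v₂ x₁ x₂ → fits x₁ b v₁ ≡ fits x₂ b v₂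
  fits-cong {v₁} {v₂} {x₁} {x₂} b (v₁≢x₁ , v₂≢x₂ , adj≡) =
    cong₂ (λ d a → not d ∧ agree a b)
          (trans (dec-false (v₁ ≟ᶠ x₁) v₁≢x₁) (≡.sym (dec-false (v₂ ≟ᶠ x₂) v₂≢x₂)))
          (trans (sym Γ x₁ v₁) (trans adj≡ (sym Γ v₂ x₂)))

  matches-cong : ∀ {m v₁ v₂} (xs₁ xs₂ : Map m n) (p : Vec Bool m) →
                 Pointwise (Compatible v₁ v₂) (toList xs₁) (toList xs₂) → matches xs₁ p v₁ ≡ matches xs₂ p v₂
  matches-cong []         []         []      []       = refl
  matches-cong (x₁ ∷ xs₁) (x₂ ∷ xs₂) (b ∷ p) (c ∷ cs) = cong₂ _∧_ (fits-cong b c) (matches-cong xs₁ xs₂ p cs)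

  numRealisations⁺ : {t m : ℕ} → Map t n → Map m n → Vec Bool m → ℕ
  numRealisations⁺ {t} ts us bs = count (λ v → matches ts (replicate t true) v ∧ matches us bs v)

  numRealisations⁺-true : {t m : ℕ} (ts : Map t n) (u : Fin n) (us : Map m n) (bs : Vec Bool m) →
                          numRealisations⁺ ts (u ∷ us) (true ∷ bs) ≡ numRealisations⁺ (u ∷ ts) us bs
  numRealisations⁺-true {t} ts u us bs = ∑-cong (allFin n) λ v →
    cong 𝟙 (trans (≡.sym (∧-assoc (matches ts (replicate t true) v) _ _))
                  (cong (_∧ matches us bs v) (∧-comm (matches ts (replicate t true) v) _)))

  numRealisations⁺-split : {t m : ℕ} (ts : Map t n) (u : Fin n) (us : Map m n) (bs : Vec Bool m) →
    numRealisations⁺ ts us bs ≡ numRealisations⁺ ts (u ∷ us) (false ∷ bs) + numRealisations⁺ (u ∷ ts) us bs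
                                + 𝟙 (matches ts (replicate t true) u ∧ matches us bs u)
  numRealisations⁺-split {t} ts u us bs = begin
    count (λ v → A v ∧ B v)
      ≡⟨ ∑-cong (allFin n) (λ v → 𝟙-split (A v) (B v) (does (v ≟ᶠ u)) (adj Γ u v)) ⟩
    ∑ (allFin n) (λ v → non-adjacent v + adjacent v + equal v)
      ≡⟨ ∑-+ (allFin n) (λ v → non-adjacent v + adjacent v) equal ⟩
    ∑ (allFin n) (λ v → non-adjacent v + adjacent v) + ∑ (allFin n) equal
      ≡⟨ cong₂ _+_ (∑-+ (allFin n) non-adjacent adjacent) (∑-allFin-δ u (λ v → A v ∧ B v)) ⟩
    numRealisations⁺ ts (u ∷ us) (false ∷ bs) + numRealisations⁺ (u ∷ ts) us bs + 𝟙 (A u ∧ B u) ∎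
    where
    open ≡-Reasoning
    A B : Fin n → Bool
    A = matches ts (replicate t true)
    B = matches us bs
    non-adjacent adjacent equal : Fin n → ℕ
    non-adjacent v = 𝟙 (A v ∧ (fits u false v ∧ B v))
    adjacent     v = 𝟙 ((fits u true v ∧ A v) ∧ B v)
    equal        v = 𝟙 (does (v ≟ᶠ u) ∧ (A v ∧ B v))

  module _ (k : ℕ) (isoregular : IsIsoregular k Γ) where

    numRealisations⁺-nil-invariant : {t : ℕ} (ts₁ ts₂ : Map t n) → t ≤ k → Similar (toList ts₁) (toList ts₂) →
                                     numRealisations⁺ ts₁ [] [] ≡ numRealisations⁺ ts₂ [] []
    numRealisations⁺-nil-invariant {t} ts₁ ts₂ t≤k s with Similar⁻ ts₁ ts₂ s
    ... | inj₁ , inj₂ , same = begin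
      numRealisations⁺ ts₁ [] []   ≡⟨ ∑-cong (allFin n) (λ v → cong 𝟙 (∧-identityʳ _)) ⟩
      numRealisations ts₁ trues    ≡⟨ numCommonNeighbours≡numRealisations ts₁ ⟨
      numCommonNeighbours Γ ts₁    ≡⟨ isoregular t t≤k ts₁ ts₂ inj₁ inj₂ same ⟩
      numCommonNeighbours Γ ts₂    ≡⟨ numCommonNeighbours≡numRealisations ts₂ ⟩
      numRealisations ts₂ trues    ≡⟨ ∑-cong (allFin n) (λ v → cong 𝟙 (∧-identityʳ _)) ⟨
      numRealisations⁺ ts₂ [] []   ∎
      where
      open ≡-Reasoning
      trues = replicate t true

    -- Induction on the pattern: a true entry joins ts, a false entry is removed by
    -- numRealisations⁺-split, so in the end only common-neighbour counts of ts remain.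
    numRealisations⁺-invariant : {t m : ℕ} (bs : Vec Bool m) (ts₁ ts₂ : Map t n) (us₁ us₂ : Map m n) →
      t + m ≤ k → Similar (toList ts₁ ++ toList us₁) (toList ts₂ ++ toList us₂) →
      numRealisations⁺ ts₁ us₁ bs ≡ numRealisations⁺ ts₂ us₂ bs
    numRealisations⁺-invariant {t} [] ts₁ ts₂ [] [] t+0≤k s =
      numRealisations⁺-nil-invariant ts₁ ts₂ (subst (_≤ k) (ℕ.+-identityʳ t) t+0≤k)
                                     (subst₂ Similar (++-identityʳ _) (++-identityʳ _) s)
    numRealisations⁺-invariant {t} {suc m} (b ∷ bs) ts₁ ts₂ (u₁ ∷ us₁) (u₂ ∷ us₂) bound s
      with Similar-toFront ts₁ ts₂ s
    ... | s′@(cons c-u s-rest) with b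
    ...   | true = begin
      numRealisations⁺ ts₁ (u₁ ∷ us₁) (true ∷ bs) ≡⟨ numRealisations⁺-true ts₁ u₁ us₁ bs ⟩
      numRealisations⁺ (u₁ ∷ ts₁) us₁ bs          ≡⟨ moved ⟩
      numRealisations⁺ (u₂ ∷ ts₂) us₂ bs          ≡⟨ numRealisations⁺-true ts₂ u₂ us₂ bs ⟨
      numRealisations⁺ ts₂ (u₂ ∷ us₂) (true ∷ bs) ∎
      where
      open ≡-Reasoning
      moved = numRealisations⁺-invariant bs (u₁ ∷ ts₁) (u₂ ∷ ts₂) us₁ us₂ (subst (_≤ k) (ℕ.+-suc t m) bound) s′
    ...   | false = +-cancelʳ₂-≡ (numRealisations⁺ (u₂ ∷ ts₂) us₂ bs) (𝟙 (matches-at u₂ ts₂ us₂)) (begin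
      numRealisations⁺ ts₁ (u₁ ∷ us₁) (false ∷ bs) + numRealisations⁺ (u₂ ∷ ts₂) us₂ bs + 𝟙 (matches-at u₂ ts₂ us₂)
        ≡⟨ cong₂ (λ y z → _ + y + z) (≡.sym moved) (≡.sym (cong 𝟙 at-u)) ⟩
      numRealisations⁺ ts₁ (u₁ ∷ us₁) (false ∷ bs) + numRealisations⁺ (u₁ ∷ ts₁) us₁ bs + 𝟙 (matches-at u₁ ts₁ us₁)
        ≡⟨ numRealisations⁺-split ts₁ u₁ us₁ bs ⟨
      numRealisations⁺ ts₁ us₁ bs
        ≡⟨ dropped ⟩
      numRealisations⁺ ts₂ us₂ bs
        ≡⟨ numRealisations⁺-split ts₂ u₂ us₂ bs ⟩
      numRealisations⁺ ts₂ (u₂ ∷ us₂) (false ∷ bs) + numRealisations⁺ (u₂ ∷ ts₂) us₂ bs + 𝟙 (matches-at u₂ ts₂ us₂) ∎)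
      where
      open ≡-Reasoning
      matches-at : Fin n → Map t n → Map m n → Bool
      matches-at u ts us = matches ts (replicate t true) u ∧ matches us bs u
      t+m≤k : t + m ≤ k
      t+m≤k = ℕ.≤-trans (ℕ.n≤1+n (t + m)) (subst (_≤ k) (ℕ.+-suc t m) bound)
      moved = numRealisations⁺-invariant bs (u₁ ∷ ts₁) (u₂ ∷ ts₂) us₁ us₂ (subst (_≤ k) (ℕ.+-suc t m) bound) s′
      dropped = numRealisations⁺-invariant bs ts₁ ts₂ us₁ us₂ t+m≤k s-rest
      at-u : matches-at u₁ ts₁ us₁ ≡ matches-at u₂ ts₂ us₂
      at-u with Pointwise-toList-++⁻ ts₁ ts₂ c-u
      ... | c-ts , c-us = cong₂ _∧_ (matches-cong ts₁ ts₂ _ c-ts) (matches-cong us₁ us₂ bs c-us)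

    isoregular⇒PatternRegular : ∀ b → b ≤ k → PatternRegular b
    isoregular⇒PatternRegular b b≤k G κ₁ κ₂ (inj₁ , edge₁) (inj₂ , edge₂) p =
      numRealisations⁺-invariant p [] [] κ₁ κ₂ b≤k
        (Similar⁺ κ₁ κ₂ inj₁ inj₂ (λ i j → trans (≡.sym (edge₁ i j)) (edge₂ i j)))

  induced : {m : ℕ} → Map m n → Graph m
  induced x = record
    { adj    = λ i j → adj Γ (lookup x i) (lookup x j)
    ; sym    = λ i j → sym Γ (lookup x i) (lookup x j)
    ; irrefl = λ i → irrefl Γ (lookup x i)
    }

  PatternRegular⇒isoregular : (k : ℕ) → (∀ j → 1 ≤ j → j ≤ k → PatternRegular j) → IsIsoregular k Γ
  PatternRegular⇒isoregular k patReg zero    _   []  []  _     _     _    = refl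
  PatternRegular⇒isoregular k patReg (suc j) j≤k x y inj-x inj-y same = begin
    numCommonNeighbours Γ x ≡⟨ numCommonNeighbours≡numRealisations x ⟩
    numRealisations x trues ≡⟨ patReg (suc j) (s≤s z≤n) j≤k (induced x) x y
                                        (inj-x , λ _ _ → refl) (inj-y , same) trues ⟩
    numRealisations y trues ≡⟨ numCommonNeighbours≡numRealisations y ⟨
    numCommonNeighbours Γ y ∎
    where
    open ≡-Reasoning
    trues = replicate (suc j) true

  -- Counting extensions along graph-types

  IsExtension : {a b : ℕ} → GraphType a b → Map a n → Map b n → Set
  IsExtension 𝕋 κ κ̂ = IsEmbedding (Θ 𝕋) Γ κ̂ × Extends (ι 𝕋) κ κ̂

  extension? : {a b : ℕ} (𝕋 : GraphType a b) (κ : Map a n) (κ̂ : Map b n) → Dec (IsExtension 𝕋 κ κ̂)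
  extension? 𝕋 κ κ̂ = isEmbedding? (Θ 𝕋) Γ κ̂ ×-dec all? (λ i → lookup κ̂ (lookup (ι 𝕋) i) ≟ᶠ lookup κ i)

  numExtensions≡∑ : {a b : ℕ} (𝕋 : GraphType a b) (κ : Map a n) →
                    numExtensions 𝕋 Γ κ ≡ ∑ (allMaps b n) (λ κ̂ → 𝟙 (does (extension? 𝕋 κ κ̂)))
  numExtensions≡∑ {b = b} 𝕋 κ = length-filter (extension? 𝕋 κ) (allMaps b n)

  -- ι is a bijection, so κ̂ = κ ∘ ι⁻¹ is forced.
  numExtensions-square : {a : ℕ} (𝕋 : GraphType a a) (κ : Map a n) → IsEmbedding (Δ 𝕋) Γ κ →
                         numExtensions 𝕋 Γ κ ≡ 1
  numExtensions-square {a} 𝕋 κ (κ-inj , κ-edge) =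
    trans (numExtensions≡∑ 𝕋 κ)
          (trans (∑-cong (allMaps a n) (λ κ̂ → 𝟙-cong (extension? 𝕋 κ κ̂) (κ̂ ≟ᵐ κ₀)
                                                       (mk⇔ unique (λ { refl → κ₀-extension }))))
                 (∑-allMaps-δ a κ₀))
    where
    ι-inj = proj₁ (ιemb 𝕋)
    ι⁻¹ : Fin a → Fin a
    ι⁻¹ j = proj₁ (injective⇒surjective (ι 𝕋) ι-inj j)
    ι∘ι⁻¹ : ∀ j → lookup (ι 𝕋) (ι⁻¹ j) ≡ j
    ι∘ι⁻¹ j = proj₂ (injective⇒surjective (ι 𝕋) ι-inj j)
    κ₀ : Map a n
    κ₀ = Vec.tabulate (lookup κ ∘ ι⁻¹)
    κ₀-lookup : ∀ j → lookup κ₀ j ≡ lookup κ (ι⁻¹ j)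
    κ₀-lookup = Vecₚ.lookup∘tabulate (lookup κ ∘ ι⁻¹)
    unique : ∀ {κ̂} → IsExtension 𝕋 κ κ̂ → κ̂ ≡ κ₀
    unique {κ̂} (_ , extends) = Pointwise-≡⇒≡ (ext λ j →
      trans (cong (lookup κ̂) (≡.sym (ι∘ι⁻¹ j))) (trans (extends (ι⁻¹ j)) (≡.sym (κ₀-lookup j))))
    κ₀-extension : IsExtension 𝕋 κ κ₀
    κ₀-extension = (κ₀-inj , κ₀-edge) , κ₀-extends
      where
      κ₀-inj : Injective κ₀
      κ₀-inj j₁ j₂ eq = trans (≡.sym (ι∘ι⁻¹ j₁)) (trans (cong (lookup (ι 𝕋))
        (κ-inj _ _ (trans (≡.sym (κ₀-lookup j₁)) (trans eq (κ₀-lookup j₂))))) (ι∘ι⁻¹ j₂))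
      κ₀-edge : ∀ j₁ j₂ → adj (Θ 𝕋) j₁ j₂ ≡ adj Γ (lookup κ₀ j₁) (lookup κ₀ j₂)
      κ₀-edge j₁ j₂ = begin
        adj (Θ 𝕋) j₁ j₂                                    ≡⟨ cong₂ (adj (Θ 𝕋)) (ι∘ι⁻¹ j₁) (ι∘ι⁻¹ j₂) ⟨
        adj (Θ 𝕋) (lookup (ι 𝕋) (ι⁻¹ j₁)) (lookup (ι 𝕋) (ι⁻¹ j₂)) ≡⟨ proj₂ (ιemb 𝕋) (ι⁻¹ j₁) (ι⁻¹ j₂) ⟨
        adj (Δ 𝕋) (ι⁻¹ j₁) (ι⁻¹ j₂)                        ≡⟨ κ-edge (ι⁻¹ j₁) (ι⁻¹ j₂) ⟩
        adj Γ (lookup κ (ι⁻¹ j₁)) (lookup κ (ι⁻¹ j₂))      ≡⟨ cong₂ (adj Γ) (κ₀-lookup j₁) (κ₀-lookup j₂) ⟨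
        adj Γ (lookup κ₀ j₁) (lookup κ₀ j₂)                ∎
        where open ≡-Reasoning
      κ₀-extends : Extends (ι 𝕋) κ κ₀
      κ₀-extends i = trans (κ₀-lookup (lookup (ι 𝕋) i)) (cong (lookup κ) (ι-inj _ _ (ι∘ι⁻¹ (lookup (ι 𝕋) i))))

  regular-square : {a : ℕ} → IsRegular[ a , a ] Γ
  regular-square 𝕋 κ₁ κ₂ e₁ e₂ = trans (numExtensions-square 𝕋 κ₁ e₁) (≡.sym (numExtensions-square 𝕋 κ₂ e₂))

  insertAt-IsEmbedding⇔ : {b : ℕ} (H : Graph (suc b)) (w : Fin (suc b)) (κ : Map b n) (v : Fin n) →
    IsEmbedding H Γ (insertAt κ w v) ⇔ (IsEmbedding (deleteVertex H w) Γ κ × Realises κ (neighbourhoodPattern H w) v)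
  insertAt-IsEmbedding⇔ H w κ v = mk⇔ to from
    where
    κ̂ = insertAt κ w v
    κ̂-w : lookup κ̂ w ≡ v
    κ̂-w = Vecₚ.insertAt-lookup κ w v
    κ̂-punchIn : ∀ j → lookup κ̂ (punchIn w j) ≡ lookup κ j
    κ̂-punchIn = Vecₚ.insertAt-punchIn κ w v
    pattern-lookup : ∀ j → lookup (neighbourhoodPattern H w) j ≡ adj H (punchIn w j) w
    pattern-lookup = Vecₚ.lookup∘tabulate (λ j → adj H (punchIn w j) w)

    to : IsEmbedding H Γ κ̂ → IsEmbedding (deleteVertex H w) Γ κ × Realises κ (neighbourhoodPattern H w) v
    to (inj , edge) = (inj⁻ , edge⁻) , realises
      where
      inj⁻ : Injective κ
      inj⁻ j₁ j₂ eq = punchIn-injective w j₁ j₂ (inj _ _ (trans (κ̂-punchIn j₁) (trans eq (≡.sym (κ̂-punchIn j₂)))))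
      edge⁻ : ∀ j₁ j₂ → adj (deleteVertex H w) j₁ j₂ ≡ adj Γ (lookup κ j₁) (lookup κ j₂)
      edge⁻ j₁ j₂ = trans (edge (punchIn w j₁) (punchIn w j₂)) (cong₂ (adj Γ) (κ̂-punchIn j₁) (κ̂-punchIn j₂))
      realises : Realises κ (neighbourhoodPattern H w) v
      realises j = (λ κj≡v → punchInᵢ≢i w j (inj _ _ (trans (κ̂-punchIn j) (trans κj≡v (≡.sym κ̂-w)))))
                 , trans (≡.sym (cong₂ (adj Γ) (κ̂-punchIn j) κ̂-w))
                         (trans (≡.sym (edge (punchIn w j) w)) (≡.sym (pattern-lookup j)))

    from : IsEmbedding (deleteVertex H w) Γ κ × Realises κ (neighbourhoodPattern H w) v → IsEmbedding H Γ κ̂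
    from ((inj⁻ , edge⁻) , realises) = inj , edge
      where
      κj≢v : ∀ j → lookup κ j ≢ v
      κj≢v j = proj₁ (realises j)
      inj : Injective κ̂
      inj j₁ j₂ eq with punchInView w j₁ | punchInView w j₂
      ... | at-w       | at-w       = refl
      ... | at-w       | punched j  = ⊥-elim (κj≢v j (trans (≡.sym (κ̂-punchIn j)) (trans (≡.sym eq) κ̂-w)))
      ... | punched j  | at-w       = ⊥-elim (κj≢v j (trans (≡.sym (κ̂-punchIn j)) (trans eq κ̂-w)))
      ... | punched i₁ | punched i₂ =
        cong (punchIn w) (inj⁻ i₁ i₂ (trans (≡.sym (κ̂-punchIn i₁)) (trans eq (κ̂-punchIn i₂))))
      edge-w : ∀ j → adj H (punchIn w j) w ≡ adj Γ (lookup κ̂ (punchIn w j)) (lookup κ̂ w)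
      edge-w j = trans (≡.sym (pattern-lookup j))
                       (trans (≡.sym (proj₂ (realises j))) (≡.sym (cong₂ (adj Γ) (κ̂-punchIn j) κ̂-w)))
      edge : ∀ j₁ j₂ → adj H j₁ j₂ ≡ adj Γ (lookup κ̂ j₁) (lookup κ̂ j₂)
      edge j₁ j₂ with punchInView w j₁ | punchInView w j₂
      ... | at-w       | at-w       = trans (irrefl H w) (≡.sym (irrefl Γ _))
      ... | at-w       | punched j  = trans (sym H w _) (trans (edge-w j) (sym Γ _ _))
      ... | punched j  | at-w       = edge-w j
      ... | punched i₁ | punched i₂ = trans (edge⁻ i₁ i₂) (≡.sym (cong₂ (adj Γ) (κ̂-punchIn i₁) (κ̂-punchIn i₂)))

  module DeleteVertex {a b : ℕ} (𝕋 : GraphType a (suc b)) (w : Fin (suc b)) (w∉ι : ∀ i → lookup (ι 𝕋) i ≢ w) where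

    ι⁻ : Map a b
    ι⁻ = Vec.tabulate (λ i → punchOut (w∉ι i ∘ ≡.sym))

    punchIn-ι⁻ : ∀ i → punchIn w (lookup ι⁻ i) ≡ lookup (ι 𝕋) i
    punchIn-ι⁻ i = trans (cong (punchIn w) (Vecₚ.lookup∘tabulate _ i)) (punchIn-punchOut _)

    𝕋⁻ : GraphType a b
    𝕋⁻ = record
      { Δ    = Δ 𝕋
      ; Θ    = deleteVertex (Θ 𝕋) w
      ; ι    = ι⁻
      ; ιemb = (λ i₁ i₂ eq → proj₁ (ιemb 𝕋) i₁ i₂
                  (trans (≡.sym (punchIn-ι⁻ i₁)) (trans (cong (punchIn w) eq) (punchIn-ι⁻ i₂))))
             , (λ i₁ i₂ → trans (proj₂ (ιemb 𝕋) i₁ i₂)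
                  (≡.sym (cong₂ (adj (Θ 𝕋)) (punchIn-ι⁻ i₁) (punchIn-ι⁻ i₂))))
      }

    pattern-w : Vec Bool b
    pattern-w = neighbourhoodPattern (Θ 𝕋) w

    IsExtension-insertAt⇔ : (κ : Map a n) (κ⁻ : Map b n) (v : Fin n) →
      IsExtension 𝕋 κ (insertAt κ⁻ w v) ⇔ (IsExtension 𝕋⁻ κ κ⁻ × T (matches κ⁻ pattern-w v))
    IsExtension-insertAt⇔ κ κ⁻ v = mk⇔
      (λ (emb , extends) → let (emb⁻ , realises) = Equivalence.to embedding⇔ emb
                           in (emb⁻ , λ i → trans (≡.sym (κ̂-ι i)) (extends i))
                            , Equivalence.from (matches⇔ κ⁻ pattern-w v) realises)
      (λ ((emb⁻ , extends⁻) , t) → Equivalence.from embedding⇔ (emb⁻ , Equivalence.to (matches⇔ κ⁻ pattern-w v) t)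
                                 , λ i → trans (κ̂-ι i) (extends⁻ i))
      where
      embedding⇔ = insertAt-IsEmbedding⇔ (Θ 𝕋) w κ⁻ v
      κ̂-ι : ∀ i → lookup (insertAt κ⁻ w v) (lookup (ι 𝕋) i) ≡ lookup κ⁻ (lookup ι⁻ i)
      κ̂-ι i = trans (cong (lookup (insertAt κ⁻ w v)) (≡.sym (punchIn-ι⁻ i))) (Vecₚ.insertAt-punchIn κ⁻ w v _)

    -- An extension of κ to Θ is an extension to Θ - w together with a vertex realising w's neighbourhood.
    numExtensions-deleteVertex : (κ : Map a n) → numExtensions 𝕋 Γ κ ≡
      ∑ (allMaps b n) (λ κ⁻ → 𝟙 (does (extension? 𝕋⁻ κ κ⁻)) * numRealisations κ⁻ pattern-w)
    numExtensions-deleteVertex κ = begin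
      numExtensions 𝕋 Γ κ
        ≡⟨ numExtensions≡∑ 𝕋 κ ⟩
      ∑ (allMaps (suc b) n) (λ κ̂ → 𝟙 (does (extension? 𝕋 κ κ̂)))
        ≡⟨ ∑-allMaps-insertAt b w _ ⟩
      ∑ (allMaps b n) (λ κ⁻ → ∑ (allFin n) (λ v → 𝟙 (does (extension? 𝕋 κ (insertAt κ⁻ w v)))))
        ≡⟨ ∑-cong (allMaps b n) (λ κ⁻ → ∑-cong (allFin n) λ v →
             trans (𝟙-cong (extension? 𝕋 κ (insertAt κ⁻ w v)) (extension? 𝕋⁻ κ κ⁻ ×-dec T? (matches κ⁻ pattern-w v))
                           (IsExtension-insertAt⇔ κ κ⁻ v))
                   (𝟙-∧ (does (extension? 𝕋⁻ κ κ⁻)) _)) ⟩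
      ∑ (allMaps b n) (λ κ⁻ → ∑ (allFin n) (λ v → 𝟙 (does (extension? 𝕋⁻ κ κ⁻)) * 𝟙 (matches κ⁻ pattern-w v)))
        ≡⟨ ∑-cong (allMaps b n) (λ κ⁻ → ∑-*ˡ (allFin n) (𝟙 (does (extension? 𝕋⁻ κ κ⁻))) (𝟙 ∘ matches κ⁻ pattern-w)) ⟩
      ∑ (allMaps b n) (λ κ⁻ → 𝟙 (does (extension? 𝕋⁻ κ κ⁻)) * numRealisations κ⁻ pattern-w) ∎
      where open ≡-Reasoning

  regular-suc : {a b : ℕ} → a ≤ b → IsRegular[ a , b ] Γ → PatternRegular b → IsRegular[ a , suc b ] Γ
  regular-suc {a} {b} a≤b regular patternRegular 𝕋 κ₁ κ₂ e₁ e₂ = begin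
    numExtensions 𝕋 Γ κ₁
      ≡⟨ numExtensions-deleteVertex κ₁ ⟩
    ∑ (allMaps b n) (λ κ⁻ → weight κ₁ κ⁻ * numRealisations κ⁻ pattern-w)
      ≡⟨ ∑-*-cong-support (allMaps b n) (weight κ₁) (weight κ₂) (λ κ⁻ → numRealisations κ⁻ pattern-w)
           (IsEmbedding (Θ 𝕋⁻) Γ) (support κ₁) (support κ₂)
           (λ x y ex ey → patternRegular (Θ 𝕋⁻) x y ex ey pattern-w)
           (trans (≡.sym (numExtensions≡∑ 𝕋⁻ κ₁)) (trans (regular 𝕋⁻ κ₁ κ₂ e₁ e₂) (numExtensions≡∑ 𝕋⁻ κ₂))) ⟩
    ∑ (allMaps b n) (λ κ⁻ → weight κ₂ κ⁻ * numRealisations κ⁻ pattern-w)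
      ≡⟨ numExtensions-deleteVertex κ₂ ⟨
    numExtensions 𝕋 Γ κ₂ ∎
    where
    open ≡-Reasoning
    outside = ∃-outsideImage (s≤s a≤b) (ι 𝕋)
    open DeleteVertex 𝕋 (proj₁ outside) (proj₂ outside)
    weight : Map a n → Map b n → ℕ
    weight κ κ⁻ = 𝟙 (does (extension? 𝕋⁻ κ κ⁻))
    support : ∀ κ κ⁻ → weight κ κ⁻ ≢ 0 → IsEmbedding (Θ 𝕋⁻) Γ κ⁻
    support κ κ⁻ = proj₁ ∘ 𝟙-nonzero (extension? 𝕋⁻ κ κ⁻)

  oneVertexType : {b : ℕ} → Graph b → Vec Bool b → GraphType b (suc b)
  oneVertexType G p = record
    { Δ    = G
    ; Θ    = addVertex G p
    ; ι    = Vec.tabulate Fin.suc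
    ; ιemb = (λ i j eq → suc-injective (trans (≡.sym (ι-lookup i)) (trans eq (ι-lookup j))))
           , (λ i j → ≡.sym (cong₂ (adj (addVertex G p)) (ι-lookup i) (ι-lookup j)))
    }
    where
    ι-lookup = Vecₚ.lookup∘tabulate Fin.suc

  numExtensions-oneVertex : {b : ℕ} (G : Graph b) (p : Vec Bool b) (κ : Map b n) → IsEmbedding G Γ κ →
                            numExtensions (oneVertexType G p) Γ κ ≡ numRealisations κ p
  numExtensions-oneVertex {b} G p κ emb = begin
    numExtensions (oneVertexType G p) Γ κ
      ≡⟨ numExtensions-deleteVertex κ ⟩
    ∑ (allMaps b n) (λ κ⁻ → weight κ⁻ * numRealisations κ⁻ pattern-w)
      ≡⟨ ∑-*-constant (allMaps b n) weight (λ κ⁻ → numRealisations κ⁻ pattern-w) (λ κ⁻ w≢0 →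
           cong₂ numRealisations (extension≡κ {κ⁻} (𝟙-nonzero (extension? 𝕋⁻ κ κ⁻) w≢0)) (Vecₚ.tabulate∘lookup p)) ⟩
    ∑ (allMaps b n) weight * numRealisations κ p
      ≡⟨ cong (_* numRealisations κ p) (trans (≡.sym (numExtensions≡∑ 𝕋⁻ κ)) (numExtensions-square 𝕋⁻ κ emb)) ⟩
    1 * numRealisations κ p
      ≡⟨ ℕ.*-identityˡ _ ⟩
    numRealisations κ p ∎
    where
    open ≡-Reasoning
    open DeleteVertex (oneVertexType G p) Fin.zero
                      (λ i eq → 0≢1+n (≡.sym (trans (≡.sym (Vecₚ.lookup∘tabulate Fin.suc i)) eq)))
    weight : Map b n → ℕ
    weight κ⁻ = 𝟙 (does (extension? 𝕋⁻ κ κ⁻))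
    extension≡κ : ∀ {κ⁻} → IsExtension 𝕋⁻ κ κ⁻ → κ⁻ ≡ κ
    extension≡κ {κ⁻} (_ , extends) =
      Pointwise-≡⇒≡ (ext λ i → trans (cong (lookup κ⁻) (≡.sym (ι⁻-lookup i))) (extends i))
      where
      ι⁻-lookup : ∀ i → lookup ι⁻ i ≡ i
      ι⁻-lookup i = suc-injective (trans (punchIn-ι⁻ i) (Vecₚ.lookup∘tabulate Fin.suc i))

  regular⇒PatternRegular : {b : ℕ} → IsRegular[ b , suc b ] Γ → PatternRegular b
  regular⇒PatternRegular regular G κ₁ κ₂ e₁ e₂ p =
    trans (≡.sym (numExtensions-oneVertex G p κ₁ e₁))
          (trans (regular (oneVertexType G p) κ₁ κ₂ e₁ e₂) (numExtensions-oneVertex G p κ₂ e₂))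

  regular-zero : {b : ℕ} → IsRegular[ 0 , b ] Γ
  regular-zero 𝕋 [] [] _ _ = refl

  regular-between : {k a b : ℕ} → (∀ l → 1 ≤ l → l ≤ k → PatternRegular l) → 1 ≤ a → a ≤′ b → b ≤ suc k →
                    IsRegular[ a , b ] Γ
  regular-between patternRegular 1≤a ≤′-refl           b≤1+k = regular-square
  regular-between patternRegular 1≤a (≤′-step a≤′b) (s≤s b≤k) =
    regular-suc (ℕ.≤′⇒≤ a≤′b) (regular-between patternRegular 1≤a a≤′b (ℕ.m≤n⇒m≤1+n b≤k))
                (patternRegular _ (ℕ.≤-trans 1≤a (ℕ.≤′⇒≤ a≤′b)) b≤k)

mainTheorem5 : ∀ {n} (Γ : Graph n) (k : ℕ) → 0 < k →
    (IsIsoregular k Γ ⇔ (∀ (l : ℕ) → 1 ≤ l → l ≤ k → IsRegular[ l , suc l ] Γ)) ×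
    ((∀ (l : ℕ) → 1 ≤ l → l ≤ k → IsRegular[ l , suc l ] Γ) ⇔ IsRegular⟨ k , suc k ⟩ Γ)
mainTheorem5 Γ k _ =
  mk⇔ isoregular⇒steps steps⇒isoregular , mk⇔ steps⇒regularUpTo regularUpTo⇒steps
  where
  Steps : Set
  Steps = ∀ l → 1 ≤ l → l ≤ k → IsRegular[ l , suc l ] Γ

  patternRegular : Steps → ∀ l → 1 ≤ l → l ≤ k → PatternRegular Γ l
  patternRegular steps l 1≤l l≤k = regular⇒PatternRegular Γ (steps l 1≤l l≤k)

  isoregular⇒steps : IsIsoregular k Γ → Steps
  isoregular⇒steps iso l _ l≤k =
    regular-suc Γ ℕ.≤-refl (regular-square Γ) (isoregular⇒PatternRegular Γ k iso l l≤k)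

  steps⇒isoregular : Steps → IsIsoregular k Γ
  steps⇒isoregular steps = PatternRegular⇒isoregular Γ k (patternRegular steps)

  steps⇒regularUpTo : Steps → IsRegular⟨ k , suc k ⟩ Γ
  steps⇒regularUpTo steps zero    b _ _   _     = regular-zero Γ
  steps⇒regularUpTo steps (suc a) b _ a≤b b≤1+k =
    regular-between Γ (patternRegular steps) (s≤s z≤n) (ℕ.≤⇒≤′ a≤b) b≤1+k

  regularUpTo⇒steps : IsRegular⟨ k , suc k ⟩ Γ → Steps
  regularUpTo⇒steps regular l _ l≤k = regular l (suc l) l≤k (ℕ.n≤1+n l) (s≤s l≤k)
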